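{- Let $\theta$ be a substitution that is arity type preserving with respect to an arity context $\Theta$, and let $\Theta' = \mathrm{ctx}(\theta)\oplus\Theta$. (1) If $E$ is a canonical type or kind that respects $\Theta'$, then there is an $E'$ that respects $\Theta$ such that $[\theta]E=E'$ is derivable. (2) If $M$ is a canonical term such that $\Theta'\vdash M:\alpha$ is derivable, then there is an $M'$ such that $[\theta]M=M'$ and $\Theta\vdash M':\alpha$ are derivable. (3) If $R$ is an atomic term such that $\Theta'\vdash R\Rightarrow\alpha$ is derivable, then either there is an atomic term $R'$ such that $[\theta]_r R = R'$ and $\Theta\vdash R'\Rightarrow\alpha$ are derivable, or there is a canonical term $M$ such that $[\theta]_r R = M:\alpha$ and $\Theta\vdash M:\alpha$ are derivable.
   Context: Canonical LF syntax: kinds $K ::= \mathrm{Type} \mid \Pi x{:}A.K$; canonical types $A,B ::= P \mid \Pi x{:}A.B$; atomic types $P ::= a \mid P\,M$; canonical terms $M ::= R \mid \lambda x.M$; atomic terms $R ::= c \mid x \mid R\,M$ (up to renaming of bound variables). Arity types are generated from $o$ by $\rightarrow$; the erasure $A^-$ of a type is $P^-=o$, $(\Pi x{:}A_1.A_2)^-=A_1^-\rightarrow A_2^-$. A substitution is a finite set of triples $\langle x,M,\alpha\rangle$ with distinct variables; $\mathrm{ctx}(\theta)=\{x:\alpha \mid \langle x,M,\alpha\rangle\in\theta\}$. An arity context $\Theta$ is a set of unique assignments of arity types to constants and variables; $\Theta_1\oplus\Theta_2$ consists of all assignments of $\Theta_1$ plus those of $\Theta_2$ to symbols not assigned in $\Theta_1$.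 Arity typing: $\Theta\vdash c\Rightarrow\alpha$ if $c:\alpha\in\Theta$; $\Theta\vdash x\Rightarrow\alpha$ if $x:\alpha\in\Theta$; $\Theta\vdash R\,M\Rightarrow\alpha$ if $\Theta\vdash R\Rightarrow\alpha'\rightarrow\alpha$ and $\Theta\vdash M:\alpha'$; $\Theta\vdash\lambda x.M:\alpha_1\rightarrow\alpha_2$ if $\{x:\alpha_1\}\oplus\Theta\vdash M:\alpha_2$; $\Theta\vdash R:o$ if $\Theta\vdash R\Rightarrow o$. A kind or type $E$ respects $\Theta$ if $E$ is $\mathrm{Type}$; or $E$ is atomic and every canonical term in it has some arity type under $\Theta$; or $E=\Pi x{:}A.E'$ with $A$ respecting $\Theta$ and $E'$ respecting $\{x:A^-\}\oplus\Theta$. $\theta$ is arity type preserving w.r.t. $\Theta$ if $\Theta\vdash M:\alpha$ for each $\langle x,M,\alpha\rangle\in\theta$. Hereditary substitution ($[\theta]M=M'$, $[\theta]_rR=R'$, $[\theta]_rR=M':\alpha'$, and for types/kinds $[\theta]E=E'$) is the least relation closed under: $[\theta]R=R'$ if $[\theta]_rR=R'$; $[\theta]R=M'$ if $[\theta]_rR=M':\alpha'$; $[\theta](\lambda x.M)=\lambda x.M'$ if $x\notin\mathrm{dom}(\theta)$, $x$ not free in $\mathrm{rng}(\theta)$ and $[\theta]M=M'$; $[\theta]_rx=M:\alpha$ if $\langle x,M,\alpha\rangle\in\theta$; $[\theta]_r(R\,M)=M''':\alpha''$ if $[\theta]_rR=\lambda x.M':\alpha'\rightarrow\alpha''$, $[\theta]M=M''$,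 $[\{\langle x,M'',\alpha'\rangle\}]M'=M'''$; $[\theta]_rc=c$; $[\theta]_rx=x$ if $x\notin\mathrm{dom}(\theta)$; $[\theta]_r(R\,M)=R'\,M'$ if $[\theta]_rR=R'$, $[\theta]M=M'$; $[\theta]a=a$; $[\theta](P\,M)=P'\,M'$ if $[\theta]P=P'$, $[\theta]M=M'$; $[\theta](\Pi x{:}A_1.A_2)=\Pi x{:}A_1'.A_2'$ with $x$ fresh for $\theta$, $[\theta]A_1=A_1'$, $[\theta]A_2=A_2'$; $[\theta]\mathrm{Type}=\mathrm{Type}$ and the analogous $\Pi$ rule for kinds. -}

module Defs where

open import Data.Nat using (ℕ; _≟_; _≡ᵇ_)
open import Data.Bool using (if_then_else_)
open import Data.Maybe using (Maybe; just; nothing)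
open import Data.List using (List; []; _∷_; _++_; map)
open import Data.List.Membership.Propositional using (_∈_; _∉_)
open import Data.List.Relation.Unary.All using (All)
open import Data.List.Relation.Unary.Unique.Propositional using (Unique)
open import Data.Product using (_×_; _,_; proj₁; ∃)
open import Data.Unit using (⊤)
open import Relation.Nullary using (¬_; yes; no)
open import Relation.Binary.PropositionalEquality using (_≡_; _≢_)

Var : Set
Var = ℕ

Const : Set
Const = ℕ

TyConst : Set
TyConst = ℕ

data Sym : Set where
  sc : Const → Sym
  sv : Var → Sym

-- Canonical LF syntax (raw, named; α-equivalence is defined below)

mutual
  data Can : Set where
    ↑ : Atm → Can
    ƛ : Var → Can → Can

  data Atm : Set where
    con : Const → Atm
    var : Var → Atm
    app : Atm → Can → Atm

data ATy : Set where
  base : TyConst → ATy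
  tapp : ATy → Can → ATy

data Ty : Set where
  atom : ATy → Ty
  Π    : Var → Ty → Ty → Ty

data Kind : Set where
  type : Kind
  Πk   : Var → Ty → Kind → Kind

infixr 5 _⇒_
data Ar : Set where
  o   : Ar
  _⇒_ : Ar → Ar → Ar

_⁻ : Ty → Ar
atom P ⁻    = o
Π x A B ⁻   = (A ⁻) ⇒ (B ⁻)

swapV : Var → Var → Var → Var
swapV a b x = if x ≡ᵇ a then b else (if x ≡ᵇ b then a else x)

mutual
  swapC : Var → Var → Can → Can
  swapC a b (↑ R)   = ↑ (swapA a b R)
  swapC a b (ƛ x M) = ƛ (swapV a b x) (swapC a b M)

  swapA : Var → Var → Atm → Atm
  swapA a b (con c)   = con c
  swapA a b (var x)   = var (swapV a b x)
  swapA a b (app R M) = app (swapA a b R) (swapC a b M)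

swapP : Var → Var → ATy → ATy
swapP a b (base c)   = base c
swapP a b (tapp P M) = tapp (swapP a b P) (swapC a b M)

swapT : Var → Var → Ty → Ty
swapT a b (atom P)  = atom (swapP a b P)
swapT a b (Π x A B) = Π (swapV a b x) (swapT a b A) (swapT a b B)

swapK : Var → Var → Kind → Kind
swapK a b type       = type
swapK a b (Πk x A K) = Πk (swapV a b x) (swapT a b A) (swapK a b K)

mutual
  namesC : Can → List Var
  namesC (↑ R)   = namesA R
  namesC (ƛ x M) = x ∷ namesC M

  namesA : Atm → List Var
  namesA (con c)   = []
  namesA (var x)   = x ∷ []
  namesA (app R M) = namesA R ++ namesC M

namesP : ATy → List Var
namesP (base c)   = []
namesP (tapp P M) = namesP P ++ namesC M

namesT : Ty → List Var
namesT (atom P)  = namesP P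
namesT (Π x A B) = x ∷ namesT A ++ namesT B

namesK : Kind → List Var
namesK type       = []
namesK (Πk x A K) = x ∷ namesT A ++ namesK K

mutual
  data FreeC (x : Var) : Can → Set where
    f↑ : ∀ {R} → FreeA x R → FreeC x (↑ R)
    fƛ : ∀ {y M} → y ≢ x → FreeC x M → FreeC x (ƛ y M)

  data FreeA (x : Var) : Atm → Set where
    fvar  : FreeA x (var x)
    fappl : ∀ {R M} → FreeA x R → FreeA x (app R M)
    fappr : ∀ {R M} → FreeC x M → FreeA x (app R M)

mutual
  data _≈C_ : Can → Can → Set where
    ≈↑ : ∀ {R R'} → R ≈A R' → ↑ R ≈C ↑ R'
    ≈ƛ : ∀ {x y M N} (z : Var) →
         z ∉ x ∷ y ∷ namesC M ++ namesC N →
         swapC x z M ≈C swapC y z N → ƛ x M ≈C ƛ y N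

  data _≈A_ : Atm → Atm → Set where
    ≈con : ∀ {c} → con c ≈A con c
    ≈var : ∀ {x} → var x ≈A var x
    ≈app : ∀ {R R' M M'} → R ≈A R' → M ≈C M' → app R M ≈A app R' M'

data _≈P_ : ATy → ATy → Set where
  ≈base : ∀ {a} → base a ≈P base a
  ≈tapp : ∀ {P P' M M'} → P ≈P P' → M ≈C M' → tapp P M ≈P tapp P' M'

data _≈T_ : Ty → Ty → Set where
  ≈atom : ∀ {P P'} → P ≈P P' → atom P ≈T atom P'
  ≈Π    : ∀ {x y A A' B B'} (z : Var) → A ≈T A' →
          z ∉ x ∷ y ∷ namesT B ++ namesT B' →
          swapT x z B ≈T swapT y z B' → Π x A B ≈T Π y A' B'

data _≈K_ : Kind → Kind → Set where
  ≈type : type ≈K type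
  ≈Πk   : ∀ {x y A A' K K'} (z : Var) → A ≈T A' →
          z ∉ x ∷ y ∷ namesK K ++ namesK K' →
          swapK x z K ≈K swapK y z K' → Πk x A K ≈K Πk y A' K'

-- Arity contexts: unique assignments of arity types to symbols,
-- represented as partial maps.

Ctx : Set
Ctx = Sym → Maybe Ar

_⊕_ : Ctx → Ctx → Ctx
(Θ₁ ⊕ Θ₂) s with Θ₁ s
... | just α  = just α
... | nothing = Θ₂ s

⟪_∶_⟫ : Var → Ar → Ctx
⟪ x ∶ α ⟫ (sc c) = nothing
⟪ x ∶ α ⟫ (sv y) with y ≟ x
... | yes _ = just α
... | no  _ = nothing

infix 4 _⊢_⇒ₐ_ _⊢_∶_

mutual
  data _⊢_⇒ₐ_ : Ctx → Atm → Ar → Set where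
    tcon : ∀ {Θ c α} → Θ (sc c) ≡ just α → Θ ⊢ con c ⇒ₐ α
    tvar : ∀ {Θ x α} → Θ (sv x) ≡ just α → Θ ⊢ var x ⇒ₐ α
    tapp : ∀ {Θ R M α α'} → Θ ⊢ R ⇒ₐ (α' ⇒ α) → Θ ⊢ M ∶ α' →
           Θ ⊢ app R M ⇒ₐ α

  data _⊢_∶_ : Ctx → Can → Ar → Set where
    tlam : ∀ {Θ x M α₁ α₂} → (⟪ x ∶ α₁ ⟫ ⊕ Θ) ⊢ M ∶ α₂ →
           Θ ⊢ ƛ x M ∶ (α₁ ⇒ α₂)
    tatm : ∀ {Θ R} → Θ ⊢ R ⇒ₐ o → Θ ⊢ ↑ R ∶ o

RespP : Ctx → ATy → Set
RespP Θ (base a)   = ⊤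
RespP Θ (tapp P M) = RespP Θ P × ∃ λ α → Θ ⊢ M ∶ α

RespT : Ctx → Ty → Set
RespT Θ (atom P)  = RespP Θ P
RespT Θ (Π x A B) = RespT Θ A × RespT (⟪ x ∶ A ⁻ ⟫ ⊕ Θ) B

RespK : Ctx → Kind → Set
RespK Θ type       = ⊤
RespK Θ (Πk x A K) = RespT Θ A × RespK (⟪ x ∶ A ⁻ ⟫ ⊕ Θ) K

-- Substitutions: finite sets of triples ⟨x, M, α⟩ (as lists)

Triple : Set
Triple = Var × Can × Ar

Subst : Set
Subst = List Triple

dom : Subst → List Var
dom θ = map proj₁ θ

Distinct : Subst → Set
Distinct θ = Unique (dom θ)

NotFreeInRng : Var → Subst → Set
NotFreeInRng x θ = All (λ t → ¬ FreeC x (proj₁ (Data.Product.proj₂ t))) θ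

FreshFor : Var → Subst → Set
FreshFor x θ = x ∉ dom θ × NotFreeInRng x θ

lookupθ : Subst → Var → Maybe Ar
lookupθ []              x = nothing
lookupθ ((y , M , α) ∷ θ) x with x ≟ y
... | yes _ = just α
... | no  _ = lookupθ θ x

ctx : Subst → Ctx
ctx θ (sc c) = nothing
ctx θ (sv x) = lookupθ θ x

ArityPreserving : Ctx → Subst → Set
ArityPreserving Θ θ = All (λ t → Θ ⊢ proj₁ (Data.Product.proj₂ t) ∶ Data.Product.proj₂ (Data.Product.proj₂ t)) θ

-- Hereditary substitution (least relation closed under the rules;
-- the extra ≈-rules express that objects are taken up to renaming of
-- bound variables)

mutual
  data SubC (θ : Subst) : Can → Can → Set where
    sR   : ∀ {R R'} → SubR θ R R' → SubC θ (↑ R) (↑ R')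
    sRM  : ∀ {R M' α'} → SubRM θ R M' α' → SubC θ (↑ R) M'
    sƛ   : ∀ {x M M'} → x ∉ dom θ → NotFreeInRng x θ → SubC θ M M' →
           SubC θ (ƛ x M) (ƛ x M')
    sαC  : ∀ {M N M'} → M ≈C N → SubC θ N M' → SubC θ M M'

  data SubRM (θ : Subst) : Atm → Can → Ar → Set where
    rmvar : ∀ {x M α} → (x , M , α) ∈ θ → SubRM θ (var x) M α
    rmapp : ∀ {R M x M' M'' M''' α' α''} →
            SubRM θ R (ƛ x M') (α' ⇒ α'') → SubC θ M M'' →
            SubC ((x , M'' , α') ∷ []) M' M''' →
            SubRM θ (app R M) M''' α''

  data SubR (θ : Subst) : Atm → Atm → Set where
    rcon : ∀ {c} → SubR θ (con c) (con c)
    rvar : ∀ {x} → x ∉ dom θ → SubR θ (var x) (var x)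
    rapp : ∀ {R R' M M'} → SubR θ R R' → SubC θ M M' →
           SubR θ (app R M) (app R' M')

data SubP (θ : Subst) : ATy → ATy → Set where
  pbase : ∀ {a} → SubP θ (base a) (base a)
  ptapp : ∀ {P P' M M'} → SubP θ P P' → SubC θ M M' →
          SubP θ (tapp P M) (tapp P' M')

data SubT (θ : Subst) : Ty → Ty → Set where
  tatom : ∀ {P P'} → SubP θ P P' → SubT θ (atom P) (atom P')
  tΠ    : ∀ {x A₁ A₁' A₂ A₂'} → FreshFor x θ →
          SubT θ A₁ A₁' → SubT θ A₂ A₂' →
          SubT θ (Π x A₁ A₂) (Π x A₁' A₂')
  sαT   : ∀ {A B A'} → A ≈T B → SubT θ B A' → SubT θ A A'

data SubK (θ : Subst) : Kind → Kind → Set where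
  ktype : SubK θ type type
  kΠ    : ∀ {x A A' K K'} → FreshFor x θ →
          SubT θ A A' → SubK θ K K' →
          SubK θ (Πk x A K) (Πk x A' K')
  sαK   : ∀ {K L K'} → K ≈K L → SubK θ L K' → SubK θ K K'

{-# OPTIONS --safe #-}
module Submission where

-- The substitution is built by a lexicographic induction on a bound n for the arity heights
-- in θ and on the size of the object, as in the paper. The only step that is not
-- structural is the hereditary one: when [θ]R = λy.N : α' → α, the argument is substituted
-- into N by the singleton substitution ⟨y, M'', α'⟩, whose arity has height below n.
-- Under a binder the bound variable is first swapped with a variable fresh for θ; swapping
-- preserves size, and arity typing and respecting are equivariant under swaps, so the
-- opened body is again well typed in ctx(θ) ⊕ Θ extended by the fresh variable.

open import Defs
open import Data.Product using (_×_; _,_; ∃; proj₁; proj₂)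
open import Data.Sum using (_⊎_; inj₁; inj₂)
open import Data.Nat using (ℕ; suc; _+_; _≤_; _⊔_; s≤s; _≟_; _≡ᵇ_)
open import Data.Nat.Properties
  using (≡ᵇ⇒≡; ≡⇒≡ᵇ; ≤-trans; ≤-refl; ≤-reflexive; m≤m+n; m≤n+m; m≤m⊔n; m≤n⊔m; m≤n⇒m≤1+n; 1+n≰n)
open import Data.Bool using (true; false)
open import Data.Bool.Properties using (T-≡; ¬-not)
open import Data.Maybe using (just; nothing)
open import Data.List using (List; []; _∷_; _++_)
open import Data.List.Extrema.Nat using (max; xs≤max)
open import Data.List.Membership.Propositional using (_∈_; _∉_)
open import Data.List.Membership.Propositional.Properties using (∈-++⁺ˡ; ∈-++⁺ʳ)
open import Data.List.Relation.Binary.Subset.Propositional using (_⊆_)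
open import Data.List.Relation.Unary.Any using (here; there)
open import Data.List.Relation.Unary.All as All using (All; []; _∷_)
open import Data.Unit using (tt)
open import Data.Empty using (⊥-elim)
open import Function using (_∘_; case_of_)
open import Function.Bundles using (Equivalence)
open import Relation.Nullary using (yes; no)
open import Relation.Binary.PropositionalEquality

≡ᵇ-refl : ∀ n → (n ≡ᵇ n) ≡ true
≡ᵇ-refl n = Equivalence.to T-≡ (≡⇒≡ᵇ n n refl)

≢⇒≡ᵇ-false : ∀ {m n} → m ≢ n → (m ≡ᵇ n) ≡ false
≢⇒≡ᵇ-false {m} {n} m≢n = ¬-not (m≢n ∘ ≡ᵇ⇒≡ m n ∘ Equivalence.from T-≡)

swapV-left : ∀ a b → swapV a b a ≡ b
swapV-left a b rewrite ≡ᵇ-refl a = refl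

swapV-right : ∀ a b → swapV a b b ≡ a
swapV-right a b with b ≟ a
... | yes refl = swapV-left b b
... | no b≢a rewrite ≢⇒≡ᵇ-false b≢a | ≡ᵇ-refl b = refl

swapV-other : ∀ {a b u} → u ≢ a → u ≢ b → swapV a b u ≡ u
swapV-other u≢a u≢b rewrite ≢⇒≡ᵇ-false u≢a | ≢⇒≡ᵇ-false u≢b = refl

swapV-involutive : ∀ a b u → swapV a b (swapV a b u) ≡ u
swapV-involutive a b u with u ≟ a | u ≟ b
... | yes refl | _ rewrite swapV-left u b = swapV-right u b
... | no _ | yes refl rewrite swapV-right a u = swapV-left a u
... | no u≢a | no u≢b rewrite swapV-other u≢a u≢b = swapV-other u≢a u≢b

swapV-injective : ∀ a b {u v} → swapV a b u ≡ swapV a b v → u ≡ v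
swapV-injective a b {u} {v} e = begin
  u                          ≡⟨ swapV-involutive a b u ⟨
  swapV a b (swapV a b u)    ≡⟨ cong (swapV a b) e ⟩
  swapV a b (swapV a b v)    ≡⟨ swapV-involutive a b v ⟩
  v                          ∎
  where open ≡-Reasoning

swapV-self : ∀ a u → swapV a a u ≡ u
swapV-self a u with u ≟ a
... | yes refl = swapV-left u u
... | no u≢a = swapV-other u≢a u≢a

swapV-compose : ∀ x z w {u} → u ≢ z → u ≢ w → swapV z w (swapV x z u) ≡ swapV x w u
swapV-compose x z w {u} u≢z u≢w with u ≟ x
... | yes refl rewrite swapV-left u z | swapV-left z w = sym (swapV-left u w)
... | no u≢x rewrite swapV-other u≢x u≢z | swapV-other u≢z u≢w = sym (swapV-other u≢x u≢w)

-- Only fresh-∉ matters; abstract so that concrete fresh names are never computed during checking.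
abstract
  fresh : List Var → Var
  fresh L = suc (max 0 L)

  fresh-∉ : ∀ L → fresh L ∉ L
  fresh-∉ L m = 1+n≰n (All.lookup (xs≤max 0 L) m)

mutual
  sizeC : Can → ℕ
  sizeC (↑ R)   = suc (sizeA R)
  sizeC (ƛ x M) = suc (sizeC M)

  sizeA : Atm → ℕ
  sizeA (con c)   = 0
  sizeA (var x)   = 0
  sizeA (app R M) = suc (sizeA R + sizeC M)

sizeT : Ty → ℕ
sizeT (atom P)  = 0
sizeT (Π x A B) = suc (sizeT A + sizeT B)

sizeK : Kind → ℕ
sizeK type       = 0
sizeK (Πk x A K) = suc (sizeK K)

mutual
  sizeC-swapC : ∀ a b M → sizeC (swapC a b M) ≡ sizeC M
  sizeC-swapC a b (↑ R)   = cong suc (sizeA-swapA a b R)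
  sizeC-swapC a b (ƛ x M) = cong suc (sizeC-swapC a b M)

  sizeA-swapA : ∀ a b R → sizeA (swapA a b R) ≡ sizeA R
  sizeA-swapA a b (con c)   = refl
  sizeA-swapA a b (var x)   = refl
  sizeA-swapA a b (app R M) = cong suc (cong₂ _+_ (sizeA-swapA a b R) (sizeC-swapC a b M))

sizeT-swapT : ∀ a b A → sizeT (swapT a b A) ≡ sizeT A
sizeT-swapT a b (atom P)  = refl
sizeT-swapT a b (Π x A B) = cong suc (cong₂ _+_ (sizeT-swapT a b A) (sizeT-swapT a b B))

sizeK-swapK : ∀ a b K → sizeK (swapK a b K) ≡ sizeK K
sizeK-swapK a b type       = refl
sizeK-swapK a b (Πk x A K) = cong suc (sizeK-swapK a b K)

Agree : List Var → (Var → Var) → (Var → Var) → Set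
Agree L f g = ∀ u → u ∈ L → f u ≡ g u

private
  cong₃ : ∀ {A B C D : Set} (f : A → B → C → D) {a a' b b' c c'} →
          a ≡ a' → b ≡ b' → c ≡ c' → f a b c ≡ f a' b' c'
  cong₃ f refl refl refl = refl

mutual
  swapC-swapC : ∀ {a b c d e g} M → Agree (namesC M) (swapV a b ∘ swapV c d) (swapV e g) →
                swapC a b (swapC c d M) ≡ swapC e g M
  swapC-swapC (↑ R)   h = cong ↑ (swapA-swapA R h)
  swapC-swapC (ƛ x M) h = cong₂ ƛ (h x (here refl)) (swapC-swapC M (λ u → h u ∘ there))

  swapA-swapA : ∀ {a b c d e g} R → Agree (namesA R) (swapV a b ∘ swapV c d) (swapV e g) →
                swapA a b (swapA c d R) ≡ swapA e g R
  swapA-swapA (con c)   h = refl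
  swapA-swapA (var x)   h = cong var (h x (here refl))
  swapA-swapA (app R M) h =
    cong₂ app (swapA-swapA R (λ u → h u ∘ ∈-++⁺ˡ)) (swapC-swapC M (λ u → h u ∘ ∈-++⁺ʳ (namesA R)))

swapP-swapP : ∀ {a b c d e g} P → Agree (namesP P) (swapV a b ∘ swapV c d) (swapV e g) →
              swapP a b (swapP c d P) ≡ swapP e g P
swapP-swapP (base x)   h = refl
swapP-swapP (tapp P M) h =
  cong₂ tapp (swapP-swapP P (λ u → h u ∘ ∈-++⁺ˡ)) (swapC-swapC M (λ u → h u ∘ ∈-++⁺ʳ (namesP P)))

swapT-swapT : ∀ {a b c d e g} A → Agree (namesT A) (swapV a b ∘ swapV c d) (swapV e g) →
              swapT a b (swapT c d A) ≡ swapT e g A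
swapT-swapT (atom P)  h = cong atom (swapP-swapP P h)
swapT-swapT (Π x A B) h =
  cong₃ Π (h x (here refl)) (swapT-swapT A (λ u → h u ∘ there ∘ ∈-++⁺ˡ))
          (swapT-swapT B (λ u → h u ∘ there ∘ ∈-++⁺ʳ (namesT A)))

swapK-swapK : ∀ {a b c d e g} K → Agree (namesK K) (swapV a b ∘ swapV c d) (swapV e g) →
              swapK a b (swapK c d K) ≡ swapK e g K
swapK-swapK type       h = refl
swapK-swapK (Πk x A K) h =
  cong₃ Πk (h x (here refl)) (swapT-swapT A (λ u → h u ∘ there ∘ ∈-++⁺ˡ))
           (swapK-swapK K (λ u → h u ∘ there ∘ ∈-++⁺ʳ (namesT A)))

mutual
  swapC-self : ∀ a M → swapC a a M ≡ M
  swapC-self a (↑ R)   = cong ↑ (swapA-self a R)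
  swapC-self a (ƛ x M) = cong₂ ƛ (swapV-self a x) (swapC-self a M)

  swapA-self : ∀ a R → swapA a a R ≡ R
  swapA-self a (con c)   = refl
  swapA-self a (var x)   = cong var (swapV-self a x)
  swapA-self a (app R M) = cong₂ app (swapA-self a R) (swapC-self a M)

swapP-self : ∀ a P → swapP a a P ≡ P
swapP-self a (base x)   = refl
swapP-self a (tapp P M) = cong₂ tapp (swapP-self a P) (swapC-self a M)

swapT-self : ∀ a A → swapT a a A ≡ A
swapT-self a (atom P)  = cong atom (swapP-self a P)
swapT-self a (Π x A B) = cong₃ Π (swapV-self a x) (swapT-self a A) (swapT-self a B)

swapK-self : ∀ a K → swapK a a K ≡ K
swapK-self a type       = refl
swapK-self a (Πk x A K) = cong₃ Πk (swapV-self a x) (swapT-self a A) (swapK-self a K)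

rename-twice : ∀ {x z w L} → z ∉ L → w ∉ L → Agree L (swapV z w ∘ swapV x z) (swapV x w)
rename-twice {x} {z} {w} z∉ w∉ u u∈ =
  swapV-compose x z w {u} (λ { refl → z∉ u∈ }) (λ { refl → w∉ u∈ })

-- The binder case compares swapped bodies, which are not subterms: hence the size bound.
private
  mutual
    ≈C-refl′ : ∀ n M → sizeC M ≤ n → M ≈C M
    ≈C-refl′ (suc n) (↑ R)   (s≤s h) = ≈↑ (≈A-refl′ n R h)
    ≈C-refl′ (suc n) (ƛ x M) (s≤s h) =
      ≈ƛ z (fresh-∉ _) (≈C-refl′ n (swapC x z M) (≤-trans (≤-reflexive (sizeC-swapC x z M)) h))
      where z = fresh (x ∷ x ∷ namesC M ++ namesC M)

    ≈A-refl′ : ∀ n R → sizeA R ≤ n → R ≈A R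
    ≈A-refl′ n       (con c)   h       = ≈con
    ≈A-refl′ n       (var x)   h       = ≈var
    ≈A-refl′ (suc n) (app R M) (s≤s h) =
      ≈app (≈A-refl′ n R (≤-trans (m≤m+n _ _) h)) (≈C-refl′ n M (≤-trans (m≤n+m _ _) h))

    ≈T-refl′ : ∀ n A → sizeT A ≤ n → A ≈T A
    ≈T-refl′ n (atom P) h = ≈atom (≈P-refl P)
    ≈T-refl′ (suc n) (Π x A B) (s≤s h) =
      ≈Π z (≈T-refl′ n A (≤-trans (m≤m+n _ _) h)) (fresh-∉ _)
         (≈T-refl′ n (swapT x z B) (≤-trans (≤-reflexive (sizeT-swapT x z B)) (≤-trans (m≤n+m _ _) h)))
      where z = fresh (x ∷ x ∷ namesT B ++ namesT B)

    ≈P-refl : ∀ P → P ≈P P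
    ≈P-refl (base x)   = ≈base
    ≈P-refl (tapp P M) = ≈tapp (≈P-refl P) (≈C-refl′ _ M ≤-refl)

  ≈K-refl′ : ∀ n K → sizeK K ≤ n → K ≈K K
  ≈K-refl′ n type h = ≈type
  ≈K-refl′ (suc n) (Πk x A K) (s≤s h) =
    ≈Πk z (≈T-refl′ _ A ≤-refl) (fresh-∉ _)
        (≈K-refl′ n (swapK x z K) (≤-trans (≤-reflexive (sizeK-swapK x z K)) h))
    where z = fresh (x ∷ x ∷ namesK K ++ namesK K)

≈C-refl : ∀ M → M ≈C M
≈C-refl M = ≈C-refl′ _ M ≤-refl

≈T-refl : ∀ A → A ≈T A
≈T-refl A = ≈T-refl′ _ A ≤-refl

≈K-refl : ∀ K → K ≈K K
≈K-refl K = ≈K-refl′ _ K ≤-refl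

ƛ-rename : ∀ x z M → z ∉ x ∷ namesC M → ƛ x M ≈C ƛ z (swapC x z M)
ƛ-rename x z M z∉ = ≈ƛ w w∉ (subst (swapC x w M ≈C_) (sym same) (≈C-refl _))
  where
  w = fresh (x ∷ z ∷ namesC M ++ namesC (swapC x z M))
  w∉ = fresh-∉ _
  same : swapC z w (swapC x z M) ≡ swapC x w M
  same = swapC-swapC M (rename-twice (z∉ ∘ there) (w∉ ∘ there ∘ there ∘ ∈-++⁺ˡ))

Π-rename : ∀ x z A B → z ∉ x ∷ namesT B → Π x A B ≈T Π z A (swapT x z B)
Π-rename x z A B z∉ = ≈Π w (≈T-refl A) w∉ (subst (swapT x w B ≈T_) (sym same) (≈T-refl _))
  where
  w = fresh (x ∷ z ∷ namesT B ++ namesT (swapT x z B))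
  w∉ = fresh-∉ _
  same : swapT z w (swapT x z B) ≡ swapT x w B
  same = swapT-swapT B (rename-twice (z∉ ∘ there) (w∉ ∘ there ∘ there ∘ ∈-++⁺ˡ))

Πk-rename : ∀ x z A K → z ∉ x ∷ namesK K → Πk x A K ≈K Πk z A (swapK x z K)
Πk-rename x z A K z∉ = ≈Πk w (≈T-refl A) w∉ (subst (swapK x w K ≈K_) (sym same) (≈K-refl _))
  where
  w = fresh (x ∷ z ∷ namesK K ++ namesK (swapK x z K))
  w∉ = fresh-∉ _
  same : swapK z w (swapK x z K) ≡ swapK x w K
  same = swapK-swapK K (rename-twice (z∉ ∘ there) (w∉ ∘ there ∘ there ∘ ∈-++⁺ˡ))

⁻-swapT : ∀ a b A → swapT a b A ⁻ ≡ A ⁻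
⁻-swapT a b (atom P)  = refl
⁻-swapT a b (Π x A B) = cong₂ _⇒_ (⁻-swapT a b A) (⁻-swapT a b B)

⁻-≈T : ∀ {A B} → A ≈T B → A ⁻ ≡ B ⁻
⁻-≈T (≈atom _) = refl
⁻-≈T (≈Π {x = x} {y} {B = B} {B'} z A≈ _ B≈) =
  cong₂ _⇒_ (⁻-≈T A≈) (trans (sym (⁻-swapT x z B)) (trans (⁻-≈T B≈) (⁻-swapT y z B')))

⁻-SubT : ∀ {θ A A'} → SubT θ A A' → A ⁻ ≡ A' ⁻
⁻-SubT (tatom _)    = refl
⁻-SubT (tΠ _ s₁ s₂) = cong₂ _⇒_ (⁻-SubT s₁) (⁻-SubT s₂)
⁻-SubT (sαT A≈ s)   = trans (⁻-≈T A≈) (⁻-SubT s)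

⊕-just : ∀ Γ₁ Γ₂ s {α} → Γ₁ s ≡ just α → (Γ₁ ⊕ Γ₂) s ≡ just α
⊕-just Γ₁ Γ₂ s e with Γ₁ s
⊕-just Γ₁ Γ₂ s refl | just _ = refl

⊕-nothing : ∀ Γ₁ Γ₂ s → Γ₁ s ≡ nothing → (Γ₁ ⊕ Γ₂) s ≡ Γ₂ s
⊕-nothing Γ₁ Γ₂ s e with Γ₁ s
⊕-nothing Γ₁ Γ₂ s refl | nothing = refl

⊕-congʳ : ∀ Γ₁ {Γ Γ'} s → Γ s ≡ Γ' s → (Γ₁ ⊕ Γ) s ≡ (Γ₁ ⊕ Γ') s
⊕-congʳ Γ₁ s e with Γ₁ s
... | just _  = refl
... | nothing = e

⊕-swap : ∀ Γ₁ Γ₂ Θ s → Γ₁ s ≡ nothing ⊎ Γ₂ s ≡ nothing →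
         (Γ₁ ⊕ (Γ₂ ⊕ Θ)) s ≡ (Γ₂ ⊕ (Γ₁ ⊕ Θ)) s
⊕-swap Γ₁ Γ₂ Θ s (inj₁ e₁) =
  trans (⊕-nothing Γ₁ _ s e₁) (⊕-congʳ Γ₂ s (sym (⊕-nothing Γ₁ Θ s e₁)))
⊕-swap Γ₁ Γ₂ Θ s (inj₂ e₂) =
  trans (⊕-congʳ Γ₁ s (⊕-nothing Γ₂ Θ s e₂)) (sym (⊕-nothing Γ₂ _ s e₂))

⟪⟫-≡ : ∀ {x y} α → y ≡ x → ⟪ x ∶ α ⟫ (sv y) ≡ just α
⟪⟫-≡ {x} {y} α y≡x with y ≟ x
... | yes _   = refl
... | no y≢x = ⊥-elim (y≢x y≡x)

⟪⟫-≢ : ∀ {x y} α → y ≢ x → ⟪ x ∶ α ⟫ (sv y) ≡ nothing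
⟪⟫-≢ {x} {y} α y≢x with y ≟ x
... | yes y≡x = ⊥-elim (y≢x y≡x)
... | no _    = refl

-- Equivariance of arity typing

record SwapsOn (a b : Var) (L : List Var) (Γ Γ' : Ctx) : Set where
  constructor mkSwapsOn
  field
    consts : ∀ c → Γ' (sc c) ≡ Γ (sc c)
    vars   : ∀ u → u ∈ L → Γ' (sv (swapV a b u)) ≡ Γ (sv u)

SwapsOn-⊆ : ∀ {a b L L' Γ Γ'} → L' ⊆ L → SwapsOn a b L Γ Γ' → SwapsOn a b L' Γ Γ'
SwapsOn-⊆ L'⊆L (mkSwapsOn consts vars) = mkSwapsOn consts λ u → vars u ∘ L'⊆L

SwapsOn-bind : ∀ {a b L Γ Γ'} x β → (∀ c → Γ' (sc c) ≡ Γ (sc c)) →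
               (∀ u → u ∈ L → u ≢ x → Γ' (sv (swapV a b u)) ≡ Γ (sv u)) →
               SwapsOn a b L (⟪ x ∶ β ⟫ ⊕ Γ) (⟪ swapV a b x ∶ β ⟫ ⊕ Γ')
SwapsOn-bind {a} {b} {L} {Γ} {Γ'} x β consts vars = mkSwapsOn consts bound
  where
  bound : ∀ u → u ∈ L → (⟪ swapV a b x ∶ β ⟫ ⊕ Γ') (sv (swapV a b u)) ≡ (⟪ x ∶ β ⟫ ⊕ Γ) (sv u)
  bound u u∈ = case u ≟ x of λ where
    (yes u≡x) → trans (⊕-just ⟪ swapV a b x ∶ β ⟫ Γ' _ (⟪⟫-≡ β (cong (swapV a b) u≡x)))
                      (sym (⊕-just ⟪ x ∶ β ⟫ Γ _ (⟪⟫-≡ β u≡x)))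
    (no u≢x)  → trans (⊕-nothing ⟪ swapV a b x ∶ β ⟫ Γ' _ (⟪⟫-≢ β (u≢x ∘ swapV-injective a b)))
                      (trans (vars u u∈ u≢x) (sym (⊕-nothing ⟪ x ∶ β ⟫ Γ _ (⟪⟫-≢ β u≢x))))

SwapsOn-under : ∀ {a b L Γ Γ'} x β → SwapsOn a b L Γ Γ' →
                SwapsOn a b L (⟪ x ∶ β ⟫ ⊕ Γ) (⟪ swapV a b x ∶ β ⟫ ⊕ Γ')
SwapsOn-under x β (mkSwapsOn consts vars) = SwapsOn-bind x β consts (λ u u∈ _ → vars u u∈)

mutual
  ⊢-swap : ∀ {a b Γ Γ' M α} → SwapsOn a b (namesC M) Γ Γ' → Γ ⊢ M ∶ α → Γ' ⊢ swapC a b M ∶ α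
  ⊢-swap sw (tlam {x = x} {α₁ = α₁} d) = tlam (⊢-swap (SwapsOn-under x α₁ (SwapsOn-⊆ there sw)) d)
  ⊢-swap sw (tatm d)                   = tatm (⇒ₐ-swap sw d)

  ⇒ₐ-swap : ∀ {a b Γ Γ' R α} → SwapsOn a b (namesA R) Γ Γ' → Γ ⊢ R ⇒ₐ α → Γ' ⊢ swapA a b R ⇒ₐ α
  ⇒ₐ-swap sw (tcon e)             = tcon (trans (SwapsOn.consts sw _) e)
  ⇒ₐ-swap sw (tvar e)             = tvar (trans (SwapsOn.vars sw _ (here refl)) e)
  ⇒ₐ-swap sw (tapp {R = R} dR dM) =
    tapp (⇒ₐ-swap (SwapsOn-⊆ ∈-++⁺ˡ sw) dR) (⊢-swap (SwapsOn-⊆ (∈-++⁺ʳ (namesA R)) sw) dM)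

RespP-swap : ∀ {a b Γ Γ'} P → SwapsOn a b (namesP P) Γ Γ' → RespP Γ P → RespP Γ' (swapP a b P)
RespP-swap (base _)   sw _           = tt
RespP-swap (tapp P M) sw (r , α , d) =
  RespP-swap P (SwapsOn-⊆ ∈-++⁺ˡ sw) r , α , ⊢-swap (SwapsOn-⊆ (∈-++⁺ʳ (namesP P)) sw) d

RespT-swap : ∀ {a b Γ Γ'} A → SwapsOn a b (namesT A) Γ Γ' → RespT Γ A → RespT Γ' (swapT a b A)
RespT-swap (atom P) sw r = RespP-swap P sw r
RespT-swap {a} {b} {Γ' = Γ'} (Π x A B) sw (rA , rB) =
  RespT-swap A (SwapsOn-⊆ (there ∘ ∈-++⁺ˡ) sw) rA ,
  subst (λ β → RespT (⟪ swapV a b x ∶ β ⟫ ⊕ Γ') (swapT a b B)) (sym (⁻-swapT a b A))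
    (RespT-swap B (SwapsOn-under x (A ⁻) (SwapsOn-⊆ (there ∘ ∈-++⁺ʳ (namesT A)) sw)) rB)

RespK-swap : ∀ {a b Γ Γ'} K → SwapsOn a b (namesK K) Γ Γ' → RespK Γ K → RespK Γ' (swapK a b K)
RespK-swap type sw r = tt
RespK-swap {a} {b} {Γ' = Γ'} (Πk x A K) sw (rA , rK) =
  RespT-swap A (SwapsOn-⊆ (there ∘ ∈-++⁺ˡ) sw) rA ,
  subst (λ β → RespK (⟪ swapV a b x ∶ β ⟫ ⊕ Γ') (swapK a b K)) (sym (⁻-swapT a b A))
    (RespK-swap K (SwapsOn-under x (A ⁻) (SwapsOn-⊆ (there ∘ ∈-++⁺ʳ (namesT A)) sw)) rK)

⟪⟫-rename : ∀ {Γ x z β L} → z ∉ L → SwapsOn x z L (⟪ x ∶ β ⟫ ⊕ Γ) (⟪ z ∶ β ⟫ ⊕ Γ)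
⟪⟫-rename {Γ} {x} {z} {β} {L} z∉ =
  subst (λ v → SwapsOn x z L (⟪ x ∶ β ⟫ ⊕ Γ) (⟪ v ∶ β ⟫ ⊕ Γ)) (swapV-left x z)
    (SwapsOn-bind x β (λ _ → refl) λ u u∈ u≢x → cong (Γ ∘ sv) (swapV-other u≢x λ { refl → z∉ u∈ }))

record Agrees (L : List Var) (Γ Γ' : Ctx) : Set where
  constructor mkAgrees
  field
    consts : ∀ c → Γ' (sc c) ≡ Γ (sc c)
    vars   : ∀ u → u ∈ L → Γ' (sv u) ≡ Γ (sv u)

≗⇒Agrees : ∀ {L Γ Γ'} → (∀ s → Γ' s ≡ Γ s) → Agrees L Γ Γ'
≗⇒Agrees Γ'≗Γ = mkAgrees (Γ'≗Γ ∘ sc) (λ u _ → Γ'≗Γ (sv u))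

-- Agreement is equivariance under the trivial swap.
Agrees⇒SwapsOn : ∀ {L Γ Γ'} a → Agrees L Γ Γ' → SwapsOn a a L Γ Γ'
Agrees⇒SwapsOn {Γ' = Γ'} a (mkAgrees consts vars) =
  mkSwapsOn consts λ u u∈ → trans (cong (Γ' ∘ sv) (swapV-self a u)) (vars u u∈)

⊢-agree : ∀ {Γ Γ' M α} → Agrees (namesC M) Γ Γ' → Γ ⊢ M ∶ α → Γ' ⊢ M ∶ α
⊢-agree {Γ' = Γ'} {M} {α} ag d =
  subst (λ N → Γ' ⊢ N ∶ α) (swapC-self 0 M) (⊢-swap (Agrees⇒SwapsOn 0 ag) d)

RespT-agree : ∀ {Γ Γ'} A → Agrees (namesT A) Γ Γ' → RespT Γ A → RespT Γ' A
RespT-agree {Γ' = Γ'} A ag r = subst (RespT Γ') (swapT-self 0 A) (RespT-swap A (Agrees⇒SwapsOn 0 ag) r)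

RespK-agree : ∀ {Γ Γ'} K → Agrees (namesK K) Γ Γ' → RespK Γ K → RespK Γ' K
RespK-agree {Γ' = Γ'} K ag r = subst (RespK Γ') (swapK-self 0 K) (RespK-swap K (Agrees⇒SwapsOn 0 ag) r)

lookupθ-∈⊎∉ : ∀ θ x → (∃ λ M → ∃ λ β → (x , M , β) ∈ θ × lookupθ θ x ≡ just β)
                      ⊎ (x ∉ dom θ × lookupθ θ x ≡ nothing)
lookupθ-∈⊎∉ []              x = inj₂ ((λ ()) , refl)
lookupθ-∈⊎∉ ((y , M , β) ∷ θ) x with x ≟ y
... | yes refl = inj₁ (M , β , here refl , refl)
... | no x≢y with lookupθ-∈⊎∉ θ x
...   | inj₁ (M' , β' , m , e) = inj₁ (M' , β' , there m , e)
...   | inj₂ (x∉ , e)          = inj₂ ((λ { (here x≡y) → x≢y x≡y ; (there m) → x∉ m }) , e)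

lookupθ-∉ : ∀ θ {x} → x ∉ dom θ → lookupθ θ x ≡ nothing
lookupθ-∉ []              x∉ = refl
lookupθ-∉ ((y , M , β) ∷ θ) {x} x∉ with x ≟ y
... | yes x≡y = ⊥-elim (x∉ (here x≡y))
... | no _    = lookupθ-∉ θ (x∉ ∘ there)

ctx-⊕-⟪⟫ : ∀ θ Θ {z} β → z ∉ dom θ → ∀ s →
           (ctx θ ⊕ (⟪ z ∶ β ⟫ ⊕ Θ)) s ≡ (⟪ z ∶ β ⟫ ⊕ (ctx θ ⊕ Θ)) s
ctx-⊕-⟪⟫ θ Θ {z} β z∉ s = ⊕-swap (ctx θ) ⟪ z ∶ β ⟫ Θ s (disjoint s)
  where
  disjoint : ∀ s → ctx θ s ≡ nothing ⊎ ⟪ z ∶ β ⟫ s ≡ nothing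
  disjoint (sc c) = inj₁ refl
  disjoint (sv u) = case u ≟ z of λ where
    (yes refl) → inj₁ (lookupθ-∉ θ z∉)
    (no u≢z)   → inj₂ (⟪⟫-≢ β u≢z)

ctx-singleton : ∀ y M α Θ s → (ctx ((y , M , α) ∷ []) ⊕ Θ) s ≡ (⟪ y ∶ α ⟫ ⊕ Θ) s
ctx-singleton y M α Θ (sc c) = refl
ctx-singleton y M α Θ (sv u) with u ≟ y
... | yes _ = refl
... | no _  = refl

⊢-open : ∀ {Θ θ x z β M α} → z ∉ x ∷ namesC M → z ∉ dom θ →
         ⟪ x ∶ β ⟫ ⊕ (ctx θ ⊕ Θ) ⊢ M ∶ α → ctx θ ⊕ (⟪ z ∶ β ⟫ ⊕ Θ) ⊢ swapC x z M ∶ α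
⊢-open {Θ} {θ} {β = β} z∉ z∉dom d =
  ⊢-agree (≗⇒Agrees (ctx-⊕-⟪⟫ θ Θ β z∉dom)) (⊢-swap (⟪⟫-rename (z∉ ∘ there)) d)

RespT-open : ∀ {Θ θ x z β} B → z ∉ x ∷ namesT B → z ∉ dom θ →
             RespT (⟪ x ∶ β ⟫ ⊕ (ctx θ ⊕ Θ)) B → RespT (ctx θ ⊕ (⟪ z ∶ β ⟫ ⊕ Θ)) (swapT x z B)
RespT-open {Θ} {θ} {x} {z} {β} B z∉ z∉dom r =
  RespT-agree (swapT x z B) (≗⇒Agrees (ctx-⊕-⟪⟫ θ Θ β z∉dom)) (RespT-swap B (⟪⟫-rename (z∉ ∘ there)) r)

RespK-open : ∀ {Θ θ x z β} K → z ∉ x ∷ namesK K → z ∉ dom θ →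
             RespK (⟪ x ∶ β ⟫ ⊕ (ctx θ ⊕ Θ)) K → RespK (ctx θ ⊕ (⟪ z ∶ β ⟫ ⊕ Θ)) (swapK x z K)
RespK-open {Θ} {θ} {x} {z} {β} K z∉ z∉dom r =
  RespK-agree (swapK x z K) (≗⇒Agrees (ctx-⊕-⟪⟫ θ Θ β z∉dom)) (RespK-swap K (⟪⟫-rename (z∉ ∘ there)) r)

rngNames : Subst → List Var
rngNames []                = []
rngNames ((_ , M , _) ∷ θ) = namesC M ++ rngNames θ

∉-rngNames : ∀ θ {z} → z ∉ rngNames θ → All (λ t → z ∉ namesC (proj₁ (proj₂ t))) θ
∉-rngNames []                z∉ = []
∉-rngNames ((_ , M , _) ∷ θ) z∉ = z∉ ∘ ∈-++⁺ˡ ∷ ∉-rngNames θ (z∉ ∘ ∈-++⁺ʳ (namesC M))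

mutual
  FreeC⇒∈namesC : ∀ {x M} → FreeC x M → x ∈ namesC M
  FreeC⇒∈namesC (f↑ f)   = FreeA⇒∈namesA f
  FreeC⇒∈namesC (fƛ _ f) = there (FreeC⇒∈namesC f)

  FreeA⇒∈namesA : ∀ {x R} → FreeA x R → x ∈ namesA R
  FreeA⇒∈namesA fvar                = here refl
  FreeA⇒∈namesA (fappl f)           = ∈-++⁺ˡ (FreeA⇒∈namesA f)
  FreeA⇒∈namesA (fappr {R = R} f)   = ∈-++⁺ʳ (namesA R) (FreeC⇒∈namesC f)

∉-rngNames⇒NotFreeInRng : ∀ θ {z} → z ∉ rngNames θ → NotFreeInRng z θ
∉-rngNames⇒NotFreeInRng θ z∉ = All.map (λ z∉M → z∉M ∘ FreeC⇒∈namesC) (∉-rngNames θ z∉)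

ArityPreserving-⟪⟫ : ∀ {Θ} θ {z} β → z ∉ rngNames θ →
                     ArityPreserving Θ θ → ArityPreserving (⟪ z ∶ β ⟫ ⊕ Θ) θ
ArityPreserving-⟪⟫ {Θ} θ {z} β z∉ ap = All.zipWith weaken (∉-rngNames θ z∉ , ap)
  where
  weaken : ∀ {M α} → z ∉ namesC M × Θ ⊢ M ∶ α → ⟪ z ∶ β ⟫ ⊕ Θ ⊢ M ∶ α
  weaken (z∉M , d) =
    ⊢-agree (mkAgrees (λ _ → refl) λ u u∈ → ⊕-nothing ⟪ z ∶ β ⟫ Θ _ (⟪⟫-≢ β λ { refl → z∉M u∈ })) d

freshBinder : ∀ (L : List Var) θ → ∃ λ z → z ∉ L × z ∉ dom θ × z ∉ rngNames θ
freshBinder L θ =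
  z , z∉ ∘ ∈-++⁺ˡ , z∉ ∘ ∈-++⁺ʳ L ∘ ∈-++⁺ˡ , z∉ ∘ ∈-++⁺ʳ L ∘ ∈-++⁺ʳ (dom θ)
  where
  z = fresh (L ++ dom θ ++ rngNames θ)
  z∉ = fresh-∉ (L ++ dom θ ++ rngNames θ)

height : Ar → ℕ
height o       = 0
height (α ⇒ β) = suc (height α ⊔ height β)

HeightsBounded : ℕ → Subst → Set
HeightsBounded n θ = All (λ t → height (proj₂ (proj₂ t)) ≤ n) θ

maxHeight : Subst → ℕ
maxHeight []                = 0
maxHeight ((_ , _ , α) ∷ θ) = height α ⊔ maxHeight θ

maxHeight-bounded : ∀ θ → HeightsBounded (maxHeight θ) θ
maxHeight-bounded []                = []
maxHeight-bounded ((_ , _ , α) ∷ θ) =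
  m≤m⊔n (height α) (maxHeight θ) ∷ All.map (λ h → ≤-trans h (m≤n⊔m (height α) (maxHeight θ))) (maxHeight-bounded θ)

-- Existence of hereditary substitutions

-- The height bound on a canonical outcome is what lets an application recurse at a smaller height.
AtomicResult : ℕ → Ctx → Subst → Atm → Ar → Set
AtomicResult n Θ θ R α =
  (∃ λ R' → SubR θ R R' × Θ ⊢ R' ⇒ₐ α) ⊎ (∃ λ M → SubRM θ R M α × Θ ⊢ M ∶ α × height α ≤ n)

var-result : ∀ {n Θ} θ → ArityPreserving Θ θ → HeightsBounded n θ →
             ∀ x {α} → (ctx θ ⊕ Θ) (sv x) ≡ just α → AtomicResult n Θ θ (var x) α
var-result {Θ = Θ} θ ap bd x e with lookupθ-∈⊎∉ θ x
... | inj₁ (M , β , m , e') with refl ← trans (sym (⊕-just (ctx θ) Θ (sv x) e')) e =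
  inj₂ (M , rmvar m , All.lookup ap m , All.lookup bd m)
... | inj₂ (x∉ , e') = inj₁ (var x , rvar x∉ , tvar (trans (sym (⊕-nothing (ctx θ) Θ (sv x) e')) e))

mutual
  SubC-exists : ∀ n f Θ θ → ArityPreserving Θ θ → HeightsBounded n θ → ∀ M α → sizeC M ≤ f →
                ctx θ ⊕ Θ ⊢ M ∶ α → ∃ λ M' → SubC θ M M' × Θ ⊢ M' ∶ α
  SubC-exists n (suc f) Θ θ ap bd (↑ R) o (s≤s h) (tatm d) with SubA-exists n f Θ θ ap bd R o h d
  ... | inj₁ (R' , s , t)     = ↑ R' , sR s , tatm t
  ... | inj₂ (M' , s , t , _) = M' , sRM s , t
  SubC-exists n (suc f) Θ θ ap bd (ƛ x M) (α₁ ⇒ α₂) (s≤s h) (tlam d)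
    with z , z∉ , z∉dom , z∉rng ← freshBinder (x ∷ namesC M) θ
    with M' , s , t ← SubC-exists n f (⟪ z ∶ α₁ ⟫ ⊕ Θ) θ (ArityPreserving-⟪⟫ θ α₁ z∉rng ap) bd
                        (swapC x z M) α₂ (≤-trans (≤-reflexive (sizeC-swapC x z M)) h) (⊢-open z∉ z∉dom d)
    = ƛ z M' , sαC (ƛ-rename x z M z∉) (sƛ z∉dom (∉-rngNames⇒NotFreeInRng θ z∉rng) s) , tlam t

  SubA-exists : ∀ n f Θ θ → ArityPreserving Θ θ → HeightsBounded n θ → ∀ R α → sizeA R ≤ f →
                ctx θ ⊕ Θ ⊢ R ⇒ₐ α → AtomicResult n Θ θ R α
  SubA-exists n f Θ θ ap bd (con c) α h (tcon e) = inj₁ (con c , rcon , tcon e)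
  SubA-exists n f Θ θ ap bd (var x) α h (tvar e) = var-result θ ap bd x e
  SubA-exists n (suc f) Θ θ ap bd (app R M) α (s≤s h) (tapp {α' = α'} dR dM) =
    app-result n Θ θ (SubA-exists n f Θ θ ap bd R (α' ⇒ α) (≤-trans (m≤m+n _ _) h) dR)
                     (SubC-exists n f Θ θ ap bd M α' (≤-trans (m≤n+m _ _) h) dM)

  app-result : ∀ n Θ θ {R M α' α} → AtomicResult n Θ θ R (α' ⇒ α) →
               (∃ λ M' → SubC θ M M' × Θ ⊢ M' ∶ α') → AtomicResult n Θ θ (app R M) α
  app-result n Θ θ (inj₁ (R' , s , t)) (M' , sM , tM) = inj₁ (app R' M' , rapp s sM , tapp t tM)
  app-result (suc n) Θ θ {α' = α'} {α} (inj₂ (ƛ y N , s , tlam t , s≤s hb)) (M' , sM , tM)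
    with N' , sN , tN ← SubC-exists n (sizeC N) Θ ((y , M' , α') ∷ []) (tM ∷ [])
                          (≤-trans (m≤m⊔n _ _) hb ∷ []) N α ≤-refl
                          (⊢-agree (≗⇒Agrees (ctx-singleton y M' α' Θ)) t)
    = inj₂ (N' , rmapp s sM sN , tN , m≤n⇒m≤1+n (≤-trans (m≤n⊔m (height α') (height α)) hb))

SubP-exists : ∀ n Θ θ → ArityPreserving Θ θ → HeightsBounded n θ → ∀ P →
              RespP (ctx θ ⊕ Θ) P → ∃ λ P' → SubP θ P P' × RespP Θ P'
SubP-exists n Θ θ ap bd (base a)   _ = base a , pbase , tt
SubP-exists n Θ θ ap bd (tapp P M) (r , α , d)
  with P' , sP , rP ← SubP-exists n Θ θ ap bd P r
  with M' , sM , tM ← SubC-exists n (sizeC M) Θ θ ap bd M α ≤-refl d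
  = tapp P' M' , ptapp sP sM , rP , α , tM

SubT-exists : ∀ n f Θ θ → ArityPreserving Θ θ → HeightsBounded n θ → ∀ A → sizeT A ≤ f →
              RespT (ctx θ ⊕ Θ) A → ∃ λ A' → SubT θ A A' × RespT Θ A'
SubT-exists n f Θ θ ap bd (atom P) _ r
  with P' , s , r' ← SubP-exists n Θ θ ap bd P r
  = atom P' , tatom s , r'
SubT-exists n (suc f) Θ θ ap bd (Π x A B) (s≤s h) (rA , rB)
  with z , z∉ , z∉dom , z∉rng ← freshBinder (x ∷ namesT B) θ
  with A' , sA , rA' ← SubT-exists n f Θ θ ap bd A (≤-trans (m≤m+n _ _) h) rA
  with B' , sB , rB' ← SubT-exists n f (⟪ z ∶ A ⁻ ⟫ ⊕ Θ) θ (ArityPreserving-⟪⟫ θ (A ⁻) z∉rng ap) bd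
                         (swapT x z B) (≤-trans (≤-reflexive (sizeT-swapT x z B)) (≤-trans (m≤n+m _ _) h))
                         (RespT-open B z∉ z∉dom rB)
  = Π z A' B' ,
    sαT (Π-rename x z A B z∉) (tΠ (z∉dom , ∉-rngNames⇒NotFreeInRng θ z∉rng) sA sB) ,
    rA' , subst (λ β → RespT (⟪ z ∶ β ⟫ ⊕ Θ) B') (⁻-SubT sA) rB'

SubK-exists : ∀ n f Θ θ → ArityPreserving Θ θ → HeightsBounded n θ → ∀ K → sizeK K ≤ f →
              RespK (ctx θ ⊕ Θ) K → ∃ λ K' → SubK θ K K' × RespK Θ K'
SubK-exists n f Θ θ ap bd type _ _ = type , ktype , tt
SubK-exists n (suc f) Θ θ ap bd (Πk x A K) (s≤s h) (rA , rK)
  with z , z∉ , z∉dom , z∉rng ← freshBinder (x ∷ namesK K) θ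
  with A' , sA , rA' ← SubT-exists n (sizeT A) Θ θ ap bd A ≤-refl rA
  with K' , sK , rK' ← SubK-exists n f (⟪ z ∶ A ⁻ ⟫ ⊕ Θ) θ (ArityPreserving-⟪⟫ θ (A ⁻) z∉rng ap) bd
                         (swapK x z K) (≤-trans (≤-reflexive (sizeK-swapK x z K)) h)
                         (RespK-open K z∉ z∉dom rK)
  = Πk z A' K' ,
    sαK (Πk-rename x z A K z∉) (kΠ (z∉dom , ∉-rngNames⇒NotFreeInRng θ z∉rng) sA sK) ,
    rA' , subst (λ β → RespK (⟪ z ∶ β ⟫ ⊕ Θ) K') (⁻-SubT sA) rK'

theorem2p8 : (Θ : Ctx) (θ : Subst) → Distinct θ → ArityPreserving Θ θ →
    (((A : Ty) → RespT (ctx θ ⊕ Θ) A →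
        ∃ λ A' → SubT θ A A' × RespT Θ A')
    × ((K : Kind) → RespK (ctx θ ⊕ Θ) K →
        ∃ λ K' → SubK θ K K' × RespK Θ K'))
  × ((M : Can) (α : Ar) → (ctx θ ⊕ Θ) ⊢ M ∶ α →
        ∃ λ M' → SubC θ M M' × Θ ⊢ M' ∶ α)
  × ((R : Atm) (α : Ar) → (ctx θ ⊕ Θ) ⊢ R ⇒ₐ α →
        (∃ λ R' → SubR θ R R' × Θ ⊢ R' ⇒ₐ α)
        ⊎ (∃ λ M → SubRM θ R M α × Θ ⊢ M ∶ α))
theorem2p8 Θ θ _ ap =
  ( (λ A r → SubT-exists n (sizeT A) Θ θ ap bd A ≤-refl r)
  , (λ K r → SubK-exists n (sizeK K) Θ θ ap bd K ≤-refl r))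
  , (λ M α d → SubC-exists n (sizeC M) Θ θ ap bd M α ≤-refl d)
  , (λ R α d → forgetHeight (SubA-exists n (sizeA R) Θ θ ap bd R α ≤-refl d))
  where
  n = maxHeight θ
  bd = maxHeight-bounded θ
  forgetHeight : ∀ {R α} → AtomicResult n Θ θ R α →
                 (∃ λ R' → SubR θ R R' × Θ ⊢ R' ⇒ₐ α) ⊎ (∃ λ M → SubRM θ R M α × Θ ⊢ M ∶ α)
  forgetHeight (inj₁ r)               = inj₁ r
  forgetHeight (inj₂ (M , s , t , _)) = inj₂ (M , s , t)
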